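{- Let $\mathbf{q}=(q_1,\dots,q_a)\in\prod_{j=1}^a L(v_1,x_j)$ and let $s=s(\mathbf{q})$. Then \[ |\mathcal{I}_{X,\mathbf{q}}| \ge (n+a-s-2)^{\frac{a}{s+1}}(n+a-1)^{\frac{sa}{s+1}}\left(\prod_{i=3}^n(n+a-i+1)\right)^s\left(\prod_{i=3}^n(n+a-i)\right)^{a-s}. \]
   Context: Standing setting: $n,a$ are integers with $2\le n\le a$; $M=K_n$ with $V(M)=\{v_1,\dots,v_n\}$; $K_{a,b}$ has partite sets $X=\{x_1,\dots,x_a\}$ and $Y=\{y_1,\dots,y_b\}$ with $b=\left(\prod_{i=0}^{n-1}(n+a-1-i)\right)^a-1$; $H=M\square K_{a,b}$ (Cartesian product). $L$ is an $(n+a-1)$-assignment for $H$ such that for each $i\in[n]$ the lists $L(v_i,x_1),\dots,L(v_i,x_a)$ are pairwise disjoint. $H_X$ is the subgraph of $H$ induced by $\{(v_i,x_j): i\in[n],j\in[a]\}$ (so $(v_i,x_j)\sim(v_{i'},x_{j'})$ in $H_X$ iff $j=j'$ and $i\ne i'$), $L_X$ is the restriction of $L$ to $V(H_X)$, and $\mathcal{C}_X$ is the set of all proper $L_X$-colorings of $H_X$. A coloring is $(n-1)$-to-1 if each color in its range is used at most $n-1$ times. For each color $q\in\bigcup_{j=1}^a L(v_1,x_j)$, $s_q=1$ if there exists $c\in\mathcal{C}_X$ with $|c^{ -1}(q)|=n$, and $s_q=0$ otherwise; for $\mathbf{q}\in\prod_{j=1}^a L(v_1,x_j)$, $s(\mathbf{q})=\sum_{j=1}^a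 s_{q_j}$, and $\mathcal{I}_{X,\mathbf{q}}$ is the set of $(n-1)$-to-1 colorings $c\in\mathcal{C}_X$ with $c(v_1,x_j)=q_j$ for all $j\in[a]$. A product over an empty range equals $1$. -}

module Defs where

open import Data.Nat using (ℕ; zero; suc; _+_; _*_; _∸_; _^_; _≤_; s≤s; z≤n)
open import Data.Fin using (Fin; zero; suc)
open import Data.Sum using (_⊎_; inj₁; inj₂)
open import Data.Product using (Σ; ∃; ∃-syntax; _×_; _,_)
open import Data.List using (List; length; map; upTo; allFin)
open import Data.Nat.ListAction using (product; sum)
open import Data.List.Membership.Propositional using (_∈_)
open import Data.List.Relation.Unary.Unique.Propositional using (Unique)
open import Relation.Binary.PropositionalEquality using (_≡_; _≢_)
open import Relation.Nullary using (¬_; ⌊_⌋)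
open import Data.Bool using (if_then_else_)
import Data.Nat as ℕ

-- prodRange lo hi f = ∏_{i=lo}^{hi} f i  (empty product = 1 when hi < lo)
prodRange : ℕ → ℕ → (ℕ → ℕ) → ℕ
prodRange lo hi f = product (map (λ k → f (lo + k)) (upTo (suc hi ∸ lo)))

sumFin : (k : ℕ) → (Fin k → ℕ) → ℕ
sumFin k f = sum (map f (allFin k))

bVal : ℕ → ℕ → ℕ
bVal n a = (prodRange 0 (n ∸ 1) (λ i → (n + a ∸ 1) ∸ i)) ^ a ∸ 1

v₁ : ∀ {n} → 2 ≤ n → Fin n
v₁ (s≤s _) = zero

-- Vertices of H = K_n □ K_{a,b}: pairs (v_i , w) with w ∈ X ⊎ Y.
-- A list assignment gives each vertex a list of colours (natural numbers).
Assignment : ℕ → ℕ → ℕ → Set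
Assignment n a b = Fin n → (Fin a ⊎ Fin b) → List ℕ

IsKAssignment : ∀ {n a b} → ℕ → Assignment n a b → Set
IsKAssignment k L = ∀ i w → Unique (L i w) × length (L i w) ≡ k

XListsDisjoint : ∀ {n a b} → Assignment n a b → Set
XListsDisjoint L = ∀ i j j' → j ≢ j' → ∀ q → q ∈ L i (inj₁ j) → ¬ (q ∈ L i (inj₁ j'))

-- colourings of H_X (vertex (v_i,x_j) ↦ c i j)
ColX : ℕ → ℕ → Set
ColX n a = Fin n → Fin a → ℕ

-- c is a proper L_X-colouring of H_X ((v_i,x_j) ~ (v_i',x_j') iff j = j', i ≠ i')
ProperLX : ∀ {n a b} → Assignment n a b → ColX n a → Set
ProperLX L c = (∀ i j → c i j ∈ L i (inj₁ j))
             × (∀ i i' j → i ≢ i' → c i j ≢ c i' j)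

preimageSize : ∀ {n a} → ColX n a → ℕ → ℕ
preimageSize {n} {a} c q =
  sumFin n (λ i → sumFin a (λ j → if ⌊ c i j ℕ.≟ q ⌋ then 1 else 0))

ToOne : ∀ {n a} → ℕ → ColX n a → Set
ToOne k c = ∀ q → preimageSize c q ≤ k

SqHolds : ∀ {n a b} → Assignment n a b → ℕ → Set
SqHolds {n} L q = ∃[ c ] (ProperLX L c × preimageSize c q ≡ n)

IsIndicatorS : ∀ {n a b} → Assignment n a b → (Fin a → ℕ) → (Fin a → ℕ) → Set
IsIndicatorS L q σ = ∀ j → (σ j ≡ 1 × SqHolds L (q j)) ⊎ (σ j ≡ 0 × ¬ SqHolds L (q j))

InI : ∀ {n a b} (h : 2 ≤ n) → Assignment n a b → (Fin a → ℕ) → ColX n a → Set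
InI {n} h L q c = ProperLX L c × ToOne (n ∸ 1) c × (∀ j → c (v₁ h) j ≡ q j)

DistinctCol : ∀ {n a} → ColX n a → ColX n a → Set
DistinctCol c c' = ∃[ i ] ∃[ j ] c i j ≢ c' i j

AtLeast : ∀ {n a} → (ColX n a → Set) → ℕ → Set
AtLeast {n} {a} P N =
  Σ (Fin N → ColX n a) λ f → (∀ k → P (f k)) × (∀ k k' → k ≢ k' → DistinctCol (f k) (f k'))

-- right-hand side raised to the power s+1:
-- (n+a-s-2)^a (n+a-1)^{sa} ((∏_{i=3}^n (n+a-i+1))^s (∏_{i=3}^n (n+a-i))^{a-s})^{s+1}
rhsPow : ℕ → ℕ → ℕ → ℕ
rhsPow n a s =
  ((n + a ∸ s ∸ 2) ^ a) * ((n + a ∸ 1) ^ (s * a)) *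
  (((prodRange 3 n (λ i → n + a + 1 ∸ i)) ^ s) *
   ((prodRange 3 n (λ i → n + a ∸ i)) ^ (a ∸ s))) ^ (s + 1)

module Submission where

-- Colour each (v₁,x_j) with q_j, then colour each column greedily downwards, every vertex
-- choosing among a fixed number of the colours of its list that avoid the colours above it.
-- Row v₂ moreover avoids every q_j′ with s_{q_j′} = 1.  This makes the colourings (n−1)-to-1:
-- a colour used n times meets every row (the lists of a row are disjoint), so it is some q_j;
-- if s_{q_j} = 1 it cannot occur in row v₂, and if s_{q_j} = 0 no proper colouring uses it
-- n times.  Rows v₃,…,v_n avoid q_j only when s_{q_j} = 0, since otherwise q_j lies in no
-- other list of column j; this leaves n+a−i+1 resp. n+a−i choices in row v_i.  In row v₂,
-- column j has x_j = K − d_j choices, where K = n+a−1, d_j ≤ s+1 and Σ_j d_j ≤ a (the lists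
-- L(v₂,x_j) are disjoint), and weighted AM–GM gives Π_j x_j^{s+1} ≥ (K−s−1)^a K^{sa}.

open import Defs
open import Data.Nat using (ℕ; zero; suc; _+_; _*_; _∸_; _^_; _≤_; _<_; s≤s; z≤n)
open import Data.Nat.Properties
open import Data.Nat.Tactic.RingSolver using (solve-∀)
import Algebra.Properties.CommutativeSemigroup as CommutativeSemigroupProperties
open import Data.Nat.ListAction using (sum; product)
open import Data.Fin using (Fin; zero; suc; toℕ; inject≤; remQuot; combine)
open import Data.Fin.Properties using (inject≤-injective; combine-remQuot; toℕ<n; ¬∀⟶∃¬; all?)
  renaming (_≟_ to _≟ᶠ_)
import Data.Fin.Properties as Finₚ
open import Data.List using (List; []; _∷_; _++_; length; concat; tabulate; filter; lookup; replicate; applyUpTo)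
open import Data.List.Properties
  using ( length-++; filter-++; filter-notAll; map-tabulate; map-applyUpTo; tabulate-cong
        ; length-replicate; length-tabulate)
open import Data.List.Membership.Propositional using (_∈_; _∉_)
open import Data.List.Membership.Propositional.Properties
  using (∈-filter⁺; ∈-filter⁻; ∈-lookup; ∈-concat⁺′; ∈-concat⁻′; ∈-tabulate⁺; ∈-tabulate⁻)
open import Data.List.Membership.DecPropositional _≟_ using (_∈?_; _∉?_)
open import Data.List.Relation.Binary.Subset.Propositional using (_⊆_)
open import Data.List.Relation.Binary.Disjoint.Propositional using (Disjoint)
import Data.List.Relation.Unary.All as All
import Data.List.Relation.Unary.All.Properties as All
open import Data.List.Relation.Unary.Any as Any using (here; there)
open import Data.List.Relation.Unary.AllPairs using ([]; _∷_)
import Data.List.Relation.Unary.AllPairs.Properties as AllPairs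
open import Data.List.Relation.Unary.Unique.Propositional using (Unique)
import Data.List.Relation.Unary.Unique.Propositional.Properties as Unique
open import Data.Product using (∃-syntax; _×_; _,_; proj₁; proj₂; uncurry)
open import Data.Product.Properties using (×-≡,≡→≡)
open import Data.Sum using (_⊎_; inj₁; inj₂)
open import Data.Empty using (⊥-elim)
open import Data.Bool using (if_then_else_)
open import Function using (_∘_; case_of_)
open import Relation.Nullary using (¬_; Dec; yes; no; ¬?; ⌊_⌋)
open import Relation.Nullary.Decidable using (decidable-stable)
open import Relation.Binary.PropositionalEquality

module +-CS = CommutativeSemigroupProperties +-commutativeSemigroup
module *-CS = CommutativeSemigroupProperties *-commutativeSemigroup

_∖_ _∩_ : List ℕ → List ℕ → List ℕ
xs ∖ F = filter (_∉? F) xs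
xs ∩ F = filter (_∈? F) xs

length-∖+∩ : ∀ xs F → length (xs ∖ F) + length (xs ∩ F) ≡ length xs
length-∖+∩ []       F = refl
length-∖+∩ (x ∷ xs) F with x ∈? F
... | yes _ = trans (+-suc _ _) (cong suc (length-∖+∩ xs F))
... | no  _ = cong suc (length-∖+∩ xs F)

Unique-⊆⇒length≤ : ∀ {xs ys : List ℕ} → Unique xs → xs ⊆ ys → length xs ≤ length ys
Unique-⊆⇒length≤ {[]}     _               _     = z≤n
Unique-⊆⇒length≤ {x ∷ xs} {ys} (x≢xs ∷ xs!) xs⊆ys = begin-strict
  length xs             ≤⟨ Unique-⊆⇒length≤ xs! (λ z∈xs → ∈-filter⁺ x≢? (xs⊆ys (there z∈xs)) (All.lookup x≢xs z∈xs)) ⟩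
  length (filter x≢? ys) <⟨ filter-notAll x≢? ys (Any.map (λ x≡y x≢y → x≢y x≡y) (xs⊆ys (here refl))) ⟩
  length ys             ∎
  where
  open ≤-Reasoning
  x≢? : ∀ y → Dec (x ≢ y)
  x≢? y = ¬? (x ≟ y)

length-∩≤ : ∀ {xs} F → Unique xs → length (xs ∩ F) ≤ length F
length-∩≤ {xs} F xs! = Unique-⊆⇒length≤ (Unique.filter⁺ (_∈? F) xs!) (proj₂ ∘ ∈-filter⁻ (_∈? F) {xs = xs})

length-∩-mono : ∀ {xs F G} → Unique xs → F ⊆ G → length (xs ∩ F) ≤ length (xs ∩ G)
length-∩-mono {xs} {F} {G} xs! F⊆G = Unique-⊆⇒length≤ {xs ∩ F} (Unique.filter⁺ (_∈? F) xs!) λ z∈ →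
  let z∈xs , z∈F = ∈-filter⁻ (_∈? F) {xs = xs} z∈ in ∈-filter⁺ (_∈? G) z∈xs (F⊆G z∈F)

length-∖ : ∀ {xs} F → Unique xs → length xs ∸ length F ≤ length (xs ∖ F)
length-∖ {xs} F xs! = begin
  length xs ∸ length F                           ≤⟨ ∸-monoʳ-≤ (length xs) (length-∩≤ {xs} F xs!) ⟩
  length xs ∸ length (xs ∩ F)                    ≡⟨ cong (_∸ length (xs ∩ F)) (length-∖+∩ xs F) ⟨
  length (xs ∖ F) + length (xs ∩ F) ∸ length (xs ∩ F) ≡⟨ m+n∸n≡m (length (xs ∖ F)) (length (xs ∩ F)) ⟩
  length (xs ∖ F)                                ∎
  where open ≤-Reasoning

∈-replicate⇒≡ : ∀ {k} {y z : ℕ} → y ∈ replicate k z → y ≡ z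
∈-replicate⇒≡ {suc k} (here y≡z) = y≡z
∈-replicate⇒≡ {suc k} (there y∈) = ∈-replicate⇒≡ y∈

lookup-injective : ∀ {xs : List ℕ} → Unique xs → ∀ {i j} → lookup xs i ≡ lookup xs j → i ≡ j
lookup-injective {x ∷ xs} _             {zero}  {zero}  _  = refl
lookup-injective {x ∷ xs} (x≢xs ∷ _)    {zero}  {suc j} eq = ⊥-elim (All.lookup x≢xs (∈-lookup j) eq)
lookup-injective {x ∷ xs} (x≢xs ∷ _)    {suc i} {zero}  eq = ⊥-elim (All.lookup x≢xs (∈-lookup i) (sym eq))
lookup-injective {x ∷ xs} (_    ∷ xs!)  {suc i} {suc j} eq = cong suc (lookup-injective xs! eq)

-- Finite sums and products

∑ ∏ : ∀ {m} → (Fin m → ℕ) → ℕ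
∑ f = sum (tabulate f)
∏ f = product (tabulate f)

sumFin≡∑ : ∀ m (f : Fin m → ℕ) → sumFin m f ≡ ∑ f
sumFin≡∑ m f = cong sum (map-tabulate (λ i → i) f)

∑-cong : ∀ {m} {f g : Fin m → ℕ} → (∀ j → f j ≡ g j) → ∑ f ≡ ∑ g
∑-cong = cong sum ∘ tabulate-cong

∑-mono-≤ : ∀ {m} {f g : Fin m → ℕ} → (∀ j → f j ≤ g j) → ∑ f ≤ ∑ g
∑-mono-≤ {zero}  f≤g = z≤n
∑-mono-≤ {suc m} f≤g = +-mono-≤ (f≤g zero) (∑-mono-≤ (f≤g ∘ suc))

∑-+ : ∀ {m} (f g : Fin m → ℕ) → ∑ (λ j → f j + g j) ≡ ∑ f + ∑ g
∑-+ {zero}  f g = refl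
∑-+ {suc m} f g = trans (cong (f zero + g zero +_) (∑-+ (f ∘ suc) (g ∘ suc)))
                        (+-CS.interchange (f zero) (g zero) (∑ (f ∘ suc)) (∑ (g ∘ suc)))

∑-const : ∀ m c → ∑ {m} (λ _ → c) ≡ m * c
∑-const zero    c = refl
∑-const (suc m) c = cong (c +_) (∑-const m c)

∑-≤-≡⇒≡ : ∀ {m} {f g : Fin m → ℕ} → (∀ j → f j ≤ g j) → ∑ f ≡ ∑ g → ∀ j → f j ≡ g j
∑-≤-≡⇒≡ {suc m} {f} {g} f≤g ∑f≡∑g = λ where
    zero    → f₀≡g₀
    (suc j) → ∑-≤-≡⇒≡ (f≤g ∘ suc) (+-cancelˡ-≡ (f zero) _ _ (trans ∑f≡∑g (cong (_+ ∑ (g ∘ suc)) (sym f₀≡g₀)))) j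
  where
  f₀≡g₀ : f zero ≡ g zero
  f₀≡g₀ = decidable-stable (f zero ≟ g zero) λ f₀≢g₀ →
    <-irrefl ∑f≡∑g (+-mono-<-≤ (≤∧≢⇒< (f≤g zero) f₀≢g₀) (∑-mono-≤ (f≤g ∘ suc)))

∏-cong : ∀ {m} {f g : Fin m → ℕ} → (∀ j → f j ≡ g j) → ∏ f ≡ ∏ g
∏-cong = cong product ∘ tabulate-cong

∏-mono-≤ : ∀ {m} {f g : Fin m → ℕ} → (∀ j → f j ≤ g j) → ∏ f ≤ ∏ g
∏-mono-≤ {zero}  f≤g = ≤-refl
∏-mono-≤ {suc m} f≤g = *-mono-≤ (f≤g zero) (∏-mono-≤ (f≤g ∘ suc))

∏-* : ∀ {m} (f g : Fin m → ℕ) → ∏ (λ j → f j * g j) ≡ ∏ f * ∏ g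
∏-* {zero}  f g = refl
∏-* {suc m} f g = trans (cong (f zero * g zero *_) (∏-* (f ∘ suc) (g ∘ suc)))
                        (*-CS.interchange (f zero) (g zero) (∏ (f ∘ suc)) (∏ (g ∘ suc)))

∏-^ : ∀ {m} c (e : Fin m → ℕ) → ∏ (λ j → c ^ e j) ≡ c ^ ∑ e
∏-^ {zero}  c e = refl
∏-^ {suc m} c e = trans (cong (c ^ e zero *_) (∏-^ c (e ∘ suc))) (sym (^-distribˡ-+-* c (e zero) (∑ (e ∘ suc))))

^-distribʳ-* : ∀ x y k → (x * y) ^ k ≡ x ^ k * y ^ k
^-distribʳ-* x y zero    = refl
^-distribʳ-* x y (suc k) = trans (cong (x * y *_) (^-distribʳ-* x y k)) (*-CS.interchange x y (x ^ k) (y ^ k))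

∏-^ʳ : ∀ {m} (f : Fin m → ℕ) k → ∏ f ^ k ≡ ∏ (λ j → f j ^ k)
∏-^ʳ {zero}  f k = ^-zeroˡ k
∏-^ʳ {suc m} f k = trans (^-distribʳ-* (f zero) (∏ (f ∘ suc)) k) (cong (f zero ^ k *_) (∏-^ʳ (f ∘ suc) k))

∑-complement : ∀ {m} c (f : Fin m → ℕ) → (∀ j → f j ≤ c) → ∑ (λ j → c ∸ f j) + ∑ f ≡ m * c
∑-complement {m} c f f≤c = begin
  ∑ (λ j → c ∸ f j) + ∑ f    ≡⟨ ∑-+ (λ j → c ∸ f j) f ⟨
  ∑ (λ j → c ∸ f j + f j)    ≡⟨ ∑-cong (λ j → m∸n+n≡m (f≤c j)) ⟩
  ∑ {m} (λ _ → c)            ≡⟨ ∑-const m c ⟩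
  m * c                      ∎
  where open ≡-Reasoning

applyUpTo≡tabulate : ∀ (h : ℕ → ℕ) m → applyUpTo h m ≡ tabulate {n = m} (h ∘ toℕ)
applyUpTo≡tabulate h zero    = refl
applyUpTo≡tabulate h (suc m) = cong (h 0 ∷_) (applyUpTo≡tabulate (h ∘ suc) m)

prodRange≡∏ : ∀ lo hi g → prodRange lo hi g ≡ ∏ {suc hi ∸ lo} (λ k → g (lo + toℕ k))
prodRange≡∏ lo hi g = cong product (trans (map-applyUpTo (λ k → k) (λ k → g (lo + k)) (suc hi ∸ lo))
                                          (applyUpTo≡tabulate (λ k → g (lo + k)) (suc hi ∸ lo)))

bit⇒≤1 : ∀ {e} → e ≡ 0 ⊎ e ≡ 1 → e ≤ 1
bit⇒≤1 (inj₁ refl) = z≤n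
bit⇒≤1 (inj₂ refl) = ≤-refl

∏-bits : ∀ {m} (f : ℕ → ℕ) (σ : Fin m → ℕ) → (∀ j → σ j ≡ 0 ⊎ σ j ≡ 1) →
         ∏ (λ j → f (σ j)) ≡ f 1 ^ ∑ σ * f 0 ^ (m ∸ ∑ σ)
∏-bits {m} f σ bit = begin
  ∏ (λ j → f (σ j))                                 ≡⟨ ∏-cong split ⟩
  ∏ (λ j → f 1 ^ σ j * f 0 ^ (1 ∸ σ j))             ≡⟨ ∏-* (λ j → f 1 ^ σ j) (λ j → f 0 ^ (1 ∸ σ j)) ⟩
  ∏ (λ j → f 1 ^ σ j) * ∏ (λ j → f 0 ^ (1 ∸ σ j))   ≡⟨ cong₂ _*_ (∏-^ (f 1) σ) (∏-^ (f 0) (λ j → 1 ∸ σ j)) ⟩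
  f 1 ^ ∑ σ * f 0 ^ ∑ (λ j → 1 ∸ σ j)                ≡⟨ cong (λ e → f 1 ^ ∑ σ * f 0 ^ e) ∑[1∸σ]≡m∸∑σ ⟩
  f 1 ^ ∑ σ * f 0 ^ (m ∸ ∑ σ)                        ∎
  where
  open ≡-Reasoning
  split : ∀ j → f (σ j) ≡ f 1 ^ σ j * f 0 ^ (1 ∸ σ j)
  split j with bit j
  ... | inj₁ σj≡0 rewrite σj≡0 = sym (trans (*-identityˡ (f 0 * 1)) (*-identityʳ (f 0)))
  ... | inj₂ σj≡1 rewrite σj≡1 = sym (trans (*-identityʳ (f 1 * 1)) (*-identityʳ (f 1)))
  ∑[1∸σ]≡m∸∑σ : ∑ (λ j → 1 ∸ σ j) ≡ m ∸ ∑ σ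
  ∑[1∸σ]≡m∸∑σ = begin
    ∑ (λ j → 1 ∸ σ j)                   ≡⟨ m+n∸n≡m (∑ (λ j → 1 ∸ σ j)) (∑ σ) ⟨
    ∑ (λ j → 1 ∸ σ j) + ∑ σ ∸ ∑ σ       ≡⟨ cong (_∸ ∑ σ) (trans (∑-complement 1 σ (bit⇒≤1 ∘ bit)) (*-identityʳ m)) ⟩
    m ∸ ∑ σ                             ∎

length-concat-tabulate : ∀ {m} (g : Fin m → List ℕ) → length (concat (tabulate g)) ≡ ∑ (length ∘ g)
length-concat-tabulate {zero}  g = refl
length-concat-tabulate {suc m} g =
  trans (length-++ (g zero)) (cong (length (g zero) +_) (length-concat-tabulate (g ∘ suc)))

concat-tabulate-∩ : ∀ {m} (ℓ : Fin m → List ℕ) F → concat (tabulate ℓ) ∩ F ≡ concat (tabulate λ j → ℓ j ∩ F)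
concat-tabulate-∩ {zero}  ℓ F = refl
concat-tabulate-∩ {suc m} ℓ F =
  trans (filter-++ (_∈? F) (ℓ zero) _) (cong ((ℓ zero ∩ F) ++_) (concat-tabulate-∩ (ℓ ∘ suc) F))

∑-length-∩≤ : ∀ {m} (ℓ : Fin m → List ℕ) F → (∀ j → Unique (ℓ j)) → (∀ {j j′} → j ≢ j′ → Disjoint (ℓ j) (ℓ j′)) →
              ∑ (λ j → length (ℓ j ∩ F)) ≤ length F
∑-length-∩≤ ℓ F ℓ! disjoint = begin
  ∑ (λ j → length (ℓ j ∩ F))         ≡⟨ length-concat-tabulate (λ j → ℓ j ∩ F) ⟨
  length (concat (tabulate λ j → ℓ j ∩ F)) ≡⟨ cong length (concat-tabulate-∩ ℓ F) ⟨
  length (concat (tabulate ℓ) ∩ F)   ≤⟨ length-∩≤ F (Unique.concat⁺ (All.tabulate⁺ ℓ!) (AllPairs.tabulate⁺ disjoint)) ⟩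
  length F                           ∎
  where open ≤-Reasoning

count : ∀ {m} → (Fin m → ℕ) → ℕ → ℕ
count g x = ∑ (λ j → if ⌊ g j ≟ x ⌋ then 1 else 0)

count≡0 : ∀ {m} {g : Fin m → ℕ} {x} → (∀ j → g j ≢ x) → count g x ≡ 0
count≡0 {zero}          g≢x = refl
count≡0 {suc m} {g} {x} g≢x with g zero ≟ x
... | yes g₀≡x = ⊥-elim (g≢x zero g₀≡x)
... | no  _    = count≡0 (g≢x ∘ suc)

count≤1 : ∀ {m} {g : Fin m → ℕ} {x} → (∀ {j j'} → g j ≡ x → g j' ≡ x → j ≡ j') → count g x ≤ 1
count≤1 {zero}          _   = z≤n
count≤1 {suc m} {g} {x} inj with g zero ≟ x
... | yes g₀≡x = ≤-reflexive (cong suc (count≡0 {g = g ∘ suc} λ j g≡x → Finₚ.0≢1+n (inj g₀≡x g≡x)))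
... | no  _    = count≤1 λ e e′ → Finₚ.suc-injective (inj e e′)

count>0⇒∃ : ∀ {m} {g : Fin m → ℕ} {x} → 0 < count g x → ∃[ j ] g j ≡ x
count>0⇒∃ {suc m} {g} {x} pos with g zero ≟ x
... | yes g₀≡x = zero , g₀≡x
... | no  _    = let j , g≡x = count>0⇒∃ pos in suc j , g≡x

module _ {n a b} (L : Assignment n a b) (disj : XListsDisjoint L) where

  list-index-unique : ∀ {i j j′ x} → x ∈ L i (inj₁ j) → x ∈ L i (inj₁ j′) → j ≡ j′
  list-index-unique {i} {j} {j′} {x} x∈ x∈′ = decidable-stable (j ≟ᶠ j′) λ j≢j′ → disj i j j′ j≢j′ x x∈ x∈′

  module _ {c : ColX n a} (c∈L : ∀ i j → c i j ∈ L i (inj₁ j)) (x : ℕ) where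

    count-row≤1 : ∀ i → count (c i) x ≤ 1
    count-row≤1 i = count≤1 λ {j} {j′} cij≡x cij′≡x →
      list-index-unique (subst (_∈ L i (inj₁ j)) cij≡x (c∈L i j)) (subst (_∈ L i (inj₁ j′)) cij′≡x (c∈L i j′))

    preimageSize≡∑count : preimageSize c x ≡ ∑ (λ i → count (c i) x)
    preimageSize≡∑count = trans (sumFin≡∑ n _) (∑-cong λ i → sumFin≡∑ a (λ j → if ⌊ c i j ≟ x ⌋ then 1 else 0))

    ∑1≡n : ∑ {n} (λ _ → 1) ≡ n
    ∑1≡n = trans (∑-const n 1) (*-identityʳ n)

    preimageSize≤n : preimageSize c x ≤ n
    preimageSize≤n = begin
      preimageSize c x         ≡⟨ preimageSize≡∑count ⟩
      ∑ (λ i → count (c i) x)  ≤⟨ ∑-mono-≤ count-row≤1 ⟩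
      ∑ {n} (λ _ → 1)          ≡⟨ ∑1≡n ⟩
      n                        ∎
      where open ≤-Reasoning

    preimageSize≡n⇒hits-every-row : preimageSize c x ≡ n → ∀ i → ∃[ j ] c i j ≡ x
    preimageSize≡n⇒hits-every-row size≡n i =
      count>0⇒∃ (≤-reflexive (sym (∑-≤-≡⇒≡ count-row≤1 (trans (sym preimageSize≡∑count) (trans size≡n (sym ∑1≡n))) i)))

  SqHolds⇒∉ : ∀ {x i i′ j} → x ∈ L i (inj₁ j) → SqHolds L x → i ≢ i′ → x ∉ L i′ (inj₁ j)
  SqHolds⇒∉ {x} {i} {i′} {j} x∈ (c , (c∈L , c-proper) , size≡n) i≢i′ x∈′
    with j₀ , cij₀≡x ← preimageSize≡n⇒hits-every-row c∈L x size≡n i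
       | j₁ , ci′j₁≡x ← preimageSize≡n⇒hits-every-row c∈L x size≡n i′
    with refl ← list-index-unique (subst (_∈ L i (inj₁ j₀)) cij₀≡x (c∈L i j₀)) x∈
       | refl ← list-index-unique (subst (_∈ L i′ (inj₁ j₁)) ci′j₁≡x (c∈L i′ j₁)) x∈′
    = c-proper i i′ j i≢i′ (trans cij₀≡x (sym ci′j₁≡x))

¬≗⇒DistinctCol : ∀ {n a} {c c′ : ColX n a} → ¬ (∀ i j → c i j ≡ c′ i j) → DistinctCol c c′
¬≗⇒DistinctCol {n} {a} {c} {c′} c≉c′ =
  let i , ¬row = ¬∀⟶∃¬ n _ (λ i → all? λ j → c i j ≟ c′ i j) c≉c′
      j , cij≢  = ¬∀⟶∃¬ a _ (λ j → c i j ≟ c′ i j) ¬row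
  in i , j , cij≢

-- Greedy list colouring of a clique

HasRoom : ∀ {m} → (Fin m → List ℕ) → (Fin m → ℕ) → ℕ → Set
HasRoom ℓ b u = ∀ k → Unique (ℓ k) × b k + (toℕ k + u) ≤ length (ℓ k)

HasRoom-tail : ∀ {m} (ℓ : Fin (suc m) → List ℕ) b {u} → HasRoom ℓ b u → HasRoom (ℓ ∘ suc) (b ∘ suc) (suc u)
HasRoom-tail ℓ b {u} room k =
  let ℓ! , fits = room (suc k) in ℓ! , subst (λ v → b (suc k) + v ≤ length (ℓ (suc k))) (sym (+-suc (toℕ k) u)) fits

pick : ∀ {r} (xs F : List ℕ) → Unique xs × r + length F ≤ length xs → Fin r → ℕ
pick {r} xs F (xs! , fits) t = lookup (xs ∖ F) (inject≤ t r≤)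
  where
  r≤ : r ≤ length (xs ∖ F)
  r≤ = ≤-trans (m+n≤o⇒m≤o∸n r fits) (length-∖ F xs!)

pick-∈ : ∀ {r} xs F room (t : Fin r) → pick xs F room t ∈ xs ∖ F
pick-∈ xs F room t = ∈-lookup _

pick-injective : ∀ {r} xs F room {t t′ : Fin r} → pick xs F room t ≡ pick xs F room t′ → t ≡ t′
pick-injective xs F (xs! , _) {t} {t′} eq =
  inject≤-injective _ _ t t′ (lookup-injective (Unique.filter⁺ (_∉? F) xs!) eq)

greedy : ∀ {m} (ℓ : Fin m → List ℕ) (b : Fin m → ℕ) (F : List ℕ) → HasRoom ℓ b (length F) →
         ((k : Fin m) → Fin (b k)) → Fin m → ℕ
greedy ℓ b F room t zero    = pick (ℓ zero) F (room zero) (t zero)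
greedy ℓ b F room t (suc k) =
  greedy (ℓ ∘ suc) (b ∘ suc) (pick (ℓ zero) F (room zero) (t zero) ∷ F) (HasRoom-tail ℓ b room) (t ∘ suc) k

greedy-∈ : ∀ {m} ℓ b F room t (k : Fin m) → greedy ℓ b F room t k ∈ ℓ k × greedy ℓ b F room t k ∉ F
greedy-∈ ℓ b F room t zero    = ∈-filter⁻ (_∉? F) (pick-∈ (ℓ zero) F (room zero) (t zero))
greedy-∈ ℓ b F room t (suc k) =
  let ∈ℓ , ∉F = greedy-∈ (ℓ ∘ suc) (b ∘ suc) _ (HasRoom-tail ℓ b room) (t ∘ suc) k in ∈ℓ , ∉F ∘ there

greedy-≢ : ∀ {m} ℓ b F room t {k k′ : Fin m} → k ≢ k′ → greedy ℓ b F room t k ≢ greedy ℓ b F room t k′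
greedy-≢ ℓ b F room t {zero}  {zero}   k≢k′ = ⊥-elim (k≢k′ refl)
greedy-≢ ℓ b F room t {zero}  {suc k′} _ eq =
  proj₂ (greedy-∈ (ℓ ∘ suc) (b ∘ suc) _ (HasRoom-tail ℓ b room) (t ∘ suc) k′) (here (sym eq))
greedy-≢ ℓ b F room t {suc k} {zero}   _ eq =
  proj₂ (greedy-∈ (ℓ ∘ suc) (b ∘ suc) _ (HasRoom-tail ℓ b room) (t ∘ suc) k) (here eq)
greedy-≢ ℓ b F room t {suc k} {suc k′} k≢k′ =
  greedy-≢ (ℓ ∘ suc) (b ∘ suc) _ (HasRoom-tail ℓ b room) (t ∘ suc) (k≢k′ ∘ cong suc)

greedy-injective : ∀ {m} ℓ b F room {t t′ : (k : Fin m) → Fin (b k)} →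
                   (∀ k → greedy ℓ b F room t k ≡ greedy ℓ b F room t′ k) → ∀ k → t k ≡ t′ k
greedy-injective ℓ b F room eq zero    = pick-injective (ℓ zero) F (room zero) (eq zero)
greedy-injective ℓ b F room {t} {t′} eq (suc k) =
  greedy-injective (ℓ ∘ suc) (b ∘ suc) (c ∷ F) room′ tails-agree k
  where
  c : ℕ
  c = pick (ℓ zero) F (room zero) (t zero)
  room′ : HasRoom (ℓ ∘ suc) (b ∘ suc) (suc (length F))
  room′ = HasRoom-tail ℓ b room
  tails-agree : ∀ k → greedy (ℓ ∘ suc) (b ∘ suc) (c ∷ F) room′ (t ∘ suc) k
                    ≡ greedy (ℓ ∘ suc) (b ∘ suc) (c ∷ F) room′ (t′ ∘ suc) k
  tails-agree k =
    trans (eq (suc k)) (cong (λ c′ → greedy (ℓ ∘ suc) (b ∘ suc) (c′ ∷ F) room′ (t′ ∘ suc) k) (sym (eq zero)))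

decode : ∀ {m} (b : Fin m → ℕ) → Fin (∏ b) → (k : Fin m) → Fin (b k)
decode b i zero    = proj₁ (remQuot {b zero} (∏ (b ∘ suc)) i)
decode b i (suc k) = decode (b ∘ suc) (proj₂ (remQuot {b zero} (∏ (b ∘ suc)) i)) k

remQuot-injective : ∀ {n} k {i i′ : Fin (n * k)} → remQuot {n} k i ≡ remQuot k i′ → i ≡ i′
remQuot-injective {n} k {i} {i′} eq = begin
  i                              ≡⟨ combine-remQuot {n} k i ⟨
  uncurry combine (remQuot {n} k i)  ≡⟨ cong (uncurry combine) eq ⟩
  uncurry combine (remQuot {n} k i′) ≡⟨ combine-remQuot {n} k i′ ⟩
  i′                             ∎
  where open ≡-Reasoning

decode-injective : ∀ {m} (b : Fin m → ℕ) {i i′} → (∀ k → decode b i k ≡ decode b i′ k) → i ≡ i′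
decode-injective {zero}  b {zero} {zero} _ = refl
decode-injective {suc m} b eq =
  remQuot-injective {b zero} (∏ (b ∘ suc)) (×-≡,≡→≡ (eq zero , decode-injective (b ∘ suc) (eq ∘ suc)))

l*[1+N]^u≤[l+u]*N^u : ∀ l u N → l + u ≤ N → l * suc N ^ u ≤ (l + u) * N ^ u
l*[1+N]^u≤[l+u]*N^u l zero    N _        = ≤-reflexive (cong (_* 1) (sym (+-identityʳ l)))
l*[1+N]^u≤[l+u]*N^u l (suc u) N l+1+u≤N = begin
  l * (suc N * suc N ^ u)    ≡⟨ *-CS.x∙yz≈y∙xz l (suc N) (suc N ^ u) ⟩
  suc N * (l * suc N ^ u)    ≤⟨ *-monoʳ-≤ (suc N) (l*[1+N]^u≤[l+u]*N^u l u N l+u≤N) ⟩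
  suc N * ((l + u) * N ^ u)  ≡⟨ *-assoc (suc N) (l + u) (N ^ u) ⟨
  suc N * (l + u) * N ^ u    ≤⟨ *-monoˡ-≤ (N ^ u) (+-monoˡ-≤ (N * (l + u)) l+u≤N) ⟩
  (N + N * (l + u)) * N ^ u  ≡⟨ cong (_* N ^ u) (regroup N l u) ⟩
  (l + suc u) * N * N ^ u    ≡⟨ *-assoc (l + suc u) N (N ^ u) ⟩
  (l + suc u) * (N * N ^ u)  ∎
  where
  open ≤-Reasoning
  l+u≤N : l + u ≤ N
  l+u≤N = ≤-trans (+-monoʳ-≤ l (n≤1+n u)) l+1+u≤N
  regroup : ∀ N l u → N + N * (l + u) ≡ (l + suc u) * N
  regroup = solve-∀

-- Weighted AM–GM: l + u is the arithmetic mean of t copies of l and u copies of l + t + u.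
am-gm : ∀ l t u → l ^ t * (l + t + u) ^ u ≤ (l + u) ^ (t + u)
am-gm l zero    u = ≤-reflexive (trans (*-identityˡ _) (cong (λ v → (v + u) ^ u) (+-identityʳ l)))
am-gm l (suc t) u = begin
  l * l ^ t * (l + suc t + u) ^ u  ≡⟨ cong (λ v → l * l ^ t * (v + u) ^ u) (+-suc l t) ⟩
  l * l ^ t * suc N ^ u            ≡⟨ *-CS.xy∙z≈y∙xz l (l ^ t) (suc N ^ u) ⟩
  l ^ t * (l * suc N ^ u)          ≤⟨ *-monoʳ-≤ (l ^ t) (l*[1+N]^u≤[l+u]*N^u l u N (+-monoˡ-≤ u (m≤m+n l t))) ⟩
  l ^ t * ((l + u) * N ^ u)        ≡⟨ *-CS.x∙yz≈y∙xz (l ^ t) (l + u) (N ^ u) ⟩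
  (l + u) * (l ^ t * N ^ u)        ≤⟨ *-monoʳ-≤ (l + u) (am-gm l t u) ⟩
  (l + u) * (l + u) ^ (t + u)      ∎
  where
  open ≤-Reasoning
  N : ℕ
  N = l + t + u

am-gm-complement : ∀ {l S x d} → x + d ≡ l + S → d ≤ S → l ^ d * (l + S) ^ (S ∸ d) ≤ x ^ S
am-gm-complement {l} {S} {x} {d} x+d≡l+S d≤S = begin
  l ^ d * (l + S) ^ u      ≡⟨ cong (λ v → l ^ d * v ^ u) (trans (cong (l +_) (sym d+u≡S)) (sym (+-assoc l d u))) ⟩
  l ^ d * (l + d + u) ^ u  ≤⟨ am-gm l d u ⟩
  (l + u) ^ (d + u)        ≡⟨ cong₂ _^_ l+u≡x d+u≡S ⟩
  x ^ S                    ∎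
  where
  open ≤-Reasoning
  u : ℕ
  u = S ∸ d
  d+u≡S : d + u ≡ S
  d+u≡S = m+[n∸m]≡n d≤S
  l+u≡x : l + u ≡ x
  l+u≡x = +-cancelʳ-≡ d (l + u) x (begin-equality
    l + u + d    ≡⟨ trans (+-assoc l u d) (cong (l +_) (+-comm u d)) ⟩
    l + (d + u)  ≡⟨ cong (l +_) d+u≡S ⟩
    l + S        ≡⟨ x+d≡l+S ⟨
    x + d        ∎)

^-trade-≤ : ∀ {l K a D E} s → l ≤ K → D ≤ a → E + D ≡ a * (s + 1) → l ^ a * K ^ (s * a) ≤ l ^ D * K ^ E
^-trade-≤ {l} {K} {a} {D} {E} s l≤K D≤a E+D≡ = begin
  l ^ a * K ^ (s * a)                 ≡⟨ cong (λ e → l ^ e * K ^ (s * a)) (m+[n∸m]≡n D≤a) ⟨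
  l ^ (D + (a ∸ D)) * K ^ (s * a)     ≡⟨ cong (_* K ^ (s * a)) (^-distribˡ-+-* l D (a ∸ D)) ⟩
  l ^ D * l ^ (a ∸ D) * K ^ (s * a)   ≤⟨ *-monoˡ-≤ (K ^ (s * a)) (*-monoʳ-≤ (l ^ D) (^-monoˡ-≤ (a ∸ D) l≤K)) ⟩
  l ^ D * K ^ (a ∸ D) * K ^ (s * a)   ≡⟨ *-assoc (l ^ D) (K ^ (a ∸ D)) (K ^ (s * a)) ⟩
  l ^ D * (K ^ (a ∸ D) * K ^ (s * a)) ≡⟨ cong (l ^ D *_) (^-distribˡ-+-* K (a ∸ D) (s * a)) ⟨
  l ^ D * K ^ (a ∸ D + s * a)         ≡⟨ cong (λ e → l ^ D * K ^ e) a∸D+s*a≡E ⟩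
  l ^ D * K ^ E                       ∎
  where
  open ≤-Reasoning
  a∸D+s*a≡E : a ∸ D + s * a ≡ E
  a∸D+s*a≡E = +-cancelʳ-≡ D _ E (begin-equality
    a ∸ D + s * a + D    ≡⟨ +-CS.xy∙z≈xz∙y (a ∸ D) (s * a) D ⟩
    a ∸ D + D + s * a    ≡⟨ cong (_+ s * a) (m∸n+n≡m D≤a) ⟩
    a + s * a            ≡⟨ a+s*a≡a*[s+1] a s ⟩
    a * (s + 1)          ≡⟨ E+D≡ ⟨
    E + D                ∎)
    where
    a+s*a≡a*[s+1] : ∀ a s → a + s * a ≡ a * (s + 1)
    a+s*a≡a*[s+1] = solve-∀

-- The colourings

module Construction {n′ a b : ℕ} (L : Assignment (2 + n′) a b) (L-size : IsKAssignment (suc (n′ + a)) L)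
  (disj : XListsDisjoint L) (q : Fin a → ℕ) (q∈L : ∀ j → q j ∈ L zero (inj₁ j))
  (σ : Fin a → ℕ) (σ-indicator : IsIndicatorS L q σ) where

  K s : ℕ
  K = suc (n′ + a)
  s = ∑ σ

  L! : ∀ i w → Unique (L i w)
  L! i w = proj₁ (L-size i w)

  |L|≡K : ∀ i w → length (L i w) ≡ K
  |L|≡K i w = proj₂ (L-size i w)

  σ-bit : ∀ j → σ j ≡ 0 ⊎ σ j ≡ 1
  σ-bit j with σ-indicator j
  ... | inj₁ (σj≡1 , _) = inj₂ σj≡1
  ... | inj₂ (σj≡0 , _) = inj₁ σj≡0

  -- σ is 0/1-valued, so replicate (σ j) (q j) is [ q j ] iff s_{q_j} = 1,
  -- and replicate (1 ∸ σ j) (q j) is [ q j ] iff s_{q_j} = 0.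
  saturated : List ℕ
  saturated = concat (tabulate λ j → replicate (σ j) (q j))

  -- Row suc k of column j is the vertex (v_{k+2}, x_j).
  forbidden : Fin a → Fin (suc n′) → List ℕ
  forbidden j zero    = q j ∷ saturated
  forbidden j (suc k) = replicate (1 ∸ σ j) (q j)

  lists : Fin a → Fin (suc n′) → List ℕ
  lists j k = L (suc k) (inj₁ j) ∖ forbidden j k

  later-choices : ℕ → Fin n′ → ℕ
  later-choices e k = 2 + n′ + a + e ∸ (3 + toℕ k)

  choices : Fin a → Fin (suc n′) → ℕ
  choices j zero    = length (lists j zero)
  choices j (suc k) = later-choices (σ j) k

  room : ∀ j → HasRoom (lists j) (choices j) 0
  room j zero    = Unique.filter⁺ _ (L! _ _) , ≤-reflexive (+-identityʳ _)
  room j (suc k) = Unique.filter⁺ _ (L! _ _) , (begin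
    later-choices (σ j) k + (suc (toℕ k) + 0)  ≡⟨ cong (later-choices (σ j) k +_) (+-identityʳ _) ⟩
    (n′ + a + σ j ∸ suc (toℕ k)) + suc (toℕ k) ≡⟨ m∸n+n≡m 1+k≤n′+a+σj ⟩
    n′ + a + σ j                               ≡⟨ K∸[1∸e]≡ (σ-bit j) ⟨
    K ∸ (1 ∸ σ j)                              ≡⟨ cong₂ _∸_ (|L|≡K _ _) (length-replicate (1 ∸ σ j)) ⟨
    length (L (suc (suc k)) (inj₁ j)) ∸ length (forbidden j (suc k))
                                               ≤⟨ length-∖ (forbidden j (suc k)) (L! _ _) ⟩
    length (lists j (suc k))                   ∎)
    where
    open ≤-Reasoning
    1+k≤n′+a+σj : suc (toℕ k) ≤ n′ + a + σ j
    1+k≤n′+a+σj = ≤-trans (toℕ<n k) (≤-trans (m≤m+n n′ a) (m≤m+n (n′ + a) (σ j)))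
    K∸[1∸e]≡ : ∀ {e} → e ≡ 0 ⊎ e ≡ 1 → K ∸ (1 ∸ e) ≡ n′ + a + e
    K∸[1∸e]≡ (inj₁ refl) = sym (+-identityʳ (n′ + a))
    K∸[1∸e]≡ (inj₂ refl) = +-comm 1 (n′ + a)

  column : (j : Fin a) → Fin (∏ (choices j)) → Fin (suc n′) → ℕ
  column j t = greedy (lists j) (choices j) [] (room j) (decode (choices j) t)

  N : ℕ
  N = ∏ (λ j → ∏ (choices j))

  index : Fin N → (j : Fin a) → Fin (∏ (choices j))
  index = decode (λ j → ∏ (choices j))

  colouring : Fin N → ColX (2 + n′) a
  colouring i zero    j = q j
  colouring i (suc k) j = column j (index i j) k

  column-∈ : ∀ j t k → column j t k ∈ L (suc k) (inj₁ j) × column j t k ∉ forbidden j k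
  column-∈ j t k =
    ∈-filter⁻ (_∉? forbidden j k) (proj₁ (greedy-∈ (lists j) (choices j) [] (room j) (decode (choices j) t) k))

  column-≢q : ∀ j t k → column j t k ≢ q j
  column-≢q j t zero    eq = proj₂ (column-∈ j t zero) (here eq)
  column-≢q j t (suc k) eq = case σ-indicator j of λ where
    (inj₁ (_ , q-saturates)) → SqHolds⇒∉ L disj (q∈L j) q-saturates (λ ())
      (subst (_∈ L (suc (suc k)) (inj₁ j)) eq (proj₁ (column-∈ j t (suc k))))
    (inj₂ (σj≡0 , _)) → proj₂ (column-∈ j t (suc k))
      (subst (λ e → column j t (suc k) ∈ replicate (1 ∸ e) (q j)) (sym σj≡0) (here eq))

  colouring-∈ : ∀ i r j → colouring i r j ∈ L r (inj₁ j)
  colouring-∈ i zero    j = q∈L j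
  colouring-∈ i (suc k) j = proj₁ (column-∈ j (index i j) k)

  colouring-proper : ∀ i r r′ j → r ≢ r′ → colouring i r j ≢ colouring i r′ j
  colouring-proper i zero    zero     j r≢r′ = ⊥-elim (r≢r′ refl)
  colouring-proper i zero    (suc k′) j _    = column-≢q j (index i j) k′ ∘ sym
  colouring-proper i (suc k) zero     j _    = column-≢q j (index i j) k
  colouring-proper i (suc k) (suc k′) j r≢r′ =
    greedy-≢ (lists j) (choices j) [] (room j) (decode (choices j) (index i j)) (r≢r′ ∘ cong suc)

  q∈saturated : ∀ {j} → σ j ≡ 1 → q j ∈ saturated
  q∈saturated {j} σj≡1 = ∈-concat⁺′ (subst (λ e → q j ∈ replicate e (q j)) (sym σj≡1) (here refl)) (∈-tabulate⁺ j)

  colouring-not-saturating : ∀ i x → preimageSize (colouring i) x ≢ 2 + n′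
  colouring-not-saturating i x size≡n =
    let j₀ , qj₀≡x  = hits zero
        j₁ , c₁j₁≡x = hits (suc zero)
    in case σ-indicator j₀ of λ where
      (inj₁ (σj₀≡1 , _)) → proj₂ (column-∈ j₁ (index i j₁) zero)
                              (there (subst (_∈ saturated) (trans qj₀≡x (sym c₁j₁≡x)) (q∈saturated σj₀≡1)))
      (inj₂ (_ , q-unsaturated)) → q-unsaturated (colouring i , (colouring-∈ i , colouring-proper i) ,
                                     subst (λ y → preimageSize (colouring i) y ≡ 2 + n′) (sym qj₀≡x) size≡n)
    where
    hits : ∀ r → ∃[ j ] colouring i r j ≡ x
    hits = preimageSize≡n⇒hits-every-row L disj (colouring-∈ i) x size≡n

  colouring-toOne : ∀ i → ToOne (suc n′) (colouring i)
  colouring-toOne i x = <⇒≤pred (≤∧≢⇒< (preimageSize≤n L disj (colouring-∈ i) x) (colouring-not-saturating i x))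

  colouring-injective : ∀ {i i′} → (∀ r j → colouring i r j ≡ colouring i′ r j) → i ≡ i′
  colouring-injective eq = decode-injective (λ j → ∏ (choices j)) λ j →
    decode-injective (choices j) (greedy-injective (lists j) (choices j) [] (room j) λ k → eq (suc k) j)

  colourings : AtLeast (InI (s≤s (s≤s z≤n)) L q) N
  colourings = colouring ,
               (λ i → (colouring-∈ i , colouring-proper i) , colouring-toOne i , λ j → refl) ,
               λ i i′ i≢i′ → ¬≗⇒DistinctCol (i≢i′ ∘ colouring-injective)

  x d : Fin a → ℕ
  x j = choices j zero
  d j = length (L (suc zero) (inj₁ j) ∩ forbidden j zero)

  x+d≡K : ∀ j → x j + d j ≡ K
  x+d≡K j = trans (length-∖+∩ (L (suc zero) (inj₁ j)) (forbidden j zero)) (|L|≡K (suc zero) (inj₁ j))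

  d≤s+1 : ∀ j → d j ≤ s + 1
  d≤s+1 j = begin
    d j                              ≤⟨ length-∩≤ (forbidden j zero) (L! (suc zero) (inj₁ j)) ⟩
    suc (length saturated)           ≡⟨ cong suc (trans (length-concat-tabulate (λ j → replicate (σ j) (q j)))
                                                         (∑-cong λ j → length-replicate (σ j))) ⟩
    suc s                            ≡⟨ +-comm 1 s ⟩
    s + 1                            ∎
    where open ≤-Reasoning

  saturated⊆q : saturated ⊆ tabulate q
  saturated⊆q y∈ =
    let ys , y∈ys , ys∈ = ∈-concat⁻′ (tabulate λ j → replicate (σ j) (q j)) y∈
        j , ys≡         = ∈-tabulate⁻ ys∈
    in subst (_∈ tabulate q) (sym (∈-replicate⇒≡ (subst (_ ∈_) ys≡ y∈ys))) (∈-tabulate⁺ j)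

  forbidden⊆q : ∀ j → forbidden j zero ⊆ tabulate q
  forbidden⊆q j (here refl) = ∈-tabulate⁺ j
  forbidden⊆q j (there y∈)  = saturated⊆q y∈

  ∑d≤a : ∑ d ≤ a
  ∑d≤a = begin
    ∑ d                                                ≤⟨ ∑-mono-≤ (λ j → length-∩-mono (L! _ _) (forbidden⊆q j)) ⟩
    ∑ (λ j → length (L (suc zero) (inj₁ j) ∩ tabulate q)) ≤⟨ ∑-length-∩≤ _ (tabulate q) (λ j → L! _ _) row₁-disjoint ⟩
    length (tabulate q)                                ≡⟨ length-tabulate q ⟩
    a                                                  ∎
    where
    open ≤-Reasoning
    row₁-disjoint : ∀ {j j′} → j ≢ j′ → Disjoint (L (suc zero) (inj₁ j)) (L (suc zero) (inj₁ j′))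
    row₁-disjoint j≢j′ (y∈ , y∈′) = disj (suc zero) _ _ j≢j′ _ y∈ y∈′

  lo : ℕ
  lo = 2 + n′ + a ∸ s ∸ 2

  lo+[s+1]≡K : lo + (s + 1) ≡ K
  lo+[s+1]≡K = begin
    2 + n′ + a ∸ s ∸ 2 + (s + 1)  ≡⟨ cong (λ m → m ∸ 2 + (s + 1)) (+-∸-assoc 2 s≤n′+a) ⟩
    n′ + a ∸ s + (s + 1)          ≡⟨ +-assoc (n′ + a ∸ s) s 1 ⟨
    n′ + a ∸ s + s + 1            ≡⟨ cong (_+ 1) (m∸n+n≡m s≤n′+a) ⟩
    n′ + a + 1                    ≡⟨ +-comm (n′ + a) 1 ⟩
    K                             ∎
    where
    open ≡-Reasoning
    s≤a : s ≤ a
    s≤a = ≤-trans (∑-mono-≤ (bit⇒≤1 ∘ σ-bit)) (≤-reflexive (trans (∑-const a 1) (*-identityʳ a)))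
    s≤n′+a : s ≤ n′ + a
    s≤n′+a = ≤-trans s≤a (m≤n+m a n′)

  ∏x^[s+1]≥ : lo ^ a * K ^ (s * a) ≤ ∏ x ^ (s + 1)
  ∏x^[s+1]≥ = begin
    lo ^ a * K ^ (s * a)                               ≤⟨ ^-trade-≤ s lo≤K ∑d≤a (∑-complement (s + 1) d d≤s+1) ⟩
    lo ^ ∑ d * K ^ ∑ (λ j → s + 1 ∸ d j)               ≡⟨ cong₂ _*_ (∏-^ lo d) (∏-^ K (λ j → s + 1 ∸ d j)) ⟨
    ∏ (λ j → lo ^ d j) * ∏ (λ j → K ^ (s + 1 ∸ d j))   ≡⟨ ∏-* (λ j → lo ^ d j) (λ j → K ^ (s + 1 ∸ d j)) ⟨
    ∏ (λ j → lo ^ d j * K ^ (s + 1 ∸ d j))             ≤⟨ ∏-mono-≤ column-bound ⟩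
    ∏ (λ j → x j ^ (s + 1))                            ≡⟨ ∏-^ʳ x (s + 1) ⟨
    ∏ x ^ (s + 1)                                      ∎
    where
    open ≤-Reasoning
    lo≤K : lo ≤ K
    lo≤K = ≤-trans (m≤m+n lo (s + 1)) (≤-reflexive lo+[s+1]≡K)
    column-bound : ∀ j → lo ^ d j * K ^ (s + 1 ∸ d j) ≤ x j ^ (s + 1)
    column-bound j = subst (λ k → lo ^ d j * k ^ (s + 1 ∸ d j) ≤ x j ^ (s + 1)) lo+[s+1]≡K
                           (am-gm-complement (trans (x+d≡K j) (sym lo+[s+1]≡K)) (d≤s+1 j))

  P : ℕ
  P = ∏ (later-choices 1) ^ s * ∏ (later-choices 0) ^ (a ∸ s)

  N≡∏x*P : N ≡ ∏ x * P
  N≡∏x*P = trans (∏-* x (λ j → ∏ (later-choices (σ j))))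
                 (cong (∏ x *_) (∏-bits (λ e → ∏ (later-choices e)) σ σ-bit))

  rhsPow≤N^[s+1] : rhsPow (2 + n′) a s ≤ N ^ (s + 1)
  rhsPow≤N^[s+1] = begin
    rhsPow (2 + n′) a s                  ≡⟨ cong (λ p → lo ^ a * K ^ (s * a) * p ^ (s + 1)) prodRanges≡P ⟩
    lo ^ a * K ^ (s * a) * P ^ (s + 1)   ≤⟨ *-monoˡ-≤ (P ^ (s + 1)) ∏x^[s+1]≥ ⟩
    ∏ x ^ (s + 1) * P ^ (s + 1)          ≡⟨ ^-distribʳ-* (∏ x) P (s + 1) ⟨
    (∏ x * P) ^ (s + 1)                  ≡⟨ cong (_^ (s + 1)) N≡∏x*P ⟨
    N ^ (s + 1)                          ∎
    where
    open ≤-Reasoning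
    prodRanges≡P : prodRange 3 (2 + n′) (λ i → 2 + n′ + a + 1 ∸ i) ^ s *
                   prodRange 3 (2 + n′) (λ i → 2 + n′ + a ∸ i) ^ (a ∸ s) ≡ P
    prodRanges≡P = cong₂ (λ P₁ P₀ → P₁ ^ s * P₀ ^ (a ∸ s))
      (prodRange≡∏ 3 (2 + n′) (λ i → 2 + n′ + a + 1 ∸ i))
      (trans (prodRange≡∏ 3 (2 + n′) (λ i → 2 + n′ + a ∸ i))
             (∏-cong {n′} λ k → cong (_∸ (3 + toℕ k)) (sym (+-identityʳ (2 + n′ + a)))))

lemma23 : (n a : ℕ) → (h : 2 ≤ n) → n ≤ a →
    (L : Assignment n a (bVal n a)) → IsKAssignment (n + a ∸ 1) L → XListsDisjoint L →
    (q : Fin a → ℕ) → (∀ j → q j ∈ L (v₁ h) (inj₁ j)) →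
    (σ : Fin a → ℕ) → IsIndicatorS L q σ →
    ∃[ N ] (AtLeast (InI h L q) N × rhsPow n a (sumFin a σ) ≤ N ^ (sumFin a σ + 1))
lemma23 (suc (suc n′)) a (s≤s (s≤s z≤n)) _ L L-size disj q q∈L σ σ-indicator =
  N , colourings , subst (λ s → rhsPow (2 + n′) a s ≤ N ^ (s + 1)) (sym (sumFin≡∑ a σ)) rhsPow≤N^[s+1]
  where open Construction L L-size disj q q∈L σ σ-indicator
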